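{- Let $k<m$ be positive integers such that either $\gcd(k,m)=1$, or $m$ is even and $k=\frac{m}{2}$. Then the Toeplitz graph $G_n(1^{k-1}01^{m-k})$ is word-representable for every positive integer $n$.
   Context: For a word $a_1a_2\cdots a_p$ over $\{0,1\}$, the Toeplitz graph $G_n(a_1a_2\cdots a_p)$ is the simple graph on vertex set $[n]=\{1,\dots,n\}$ in which distinct vertices $x,y$ are adjacent if and only if $a_r=1$, where $r\in[p]$ is such that $r\equiv |x-y|\pmod p$. (Equivalently it is the Riordan graph $G_n\big(\frac{a_1+a_2z+\cdots+a_pz^{p-1}}{1-z^p},z\big)$.) For a letter $c$, $c^j$ denotes $c$ repeated $j$ times, so $1^{k-1}01^{m-k}$ is the word of length $m$ with a single $0$ in position $k$ and $1$ elsewhere; thus $x\sim y$ in $G_n(1^{k-1}01^{m-k})$ iff $|x-y|\not\equiv k\pmod m$. Two distinct letters $x,y$ alternate in a word $w$ if deleting all other letters from $w$ yields a word of the form $xyxy\cdots$ or $yxyx\cdots$ (of even or odd length). A graph $G=(V,E)$ is word-representable if there is a word $w$ over the alphabet $V$ such that for all distinct $x,y\in V$, $x$ and $y$ alternate in $w$ if and only if $xy\in E$. -}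

module Defs where

open import Data.Nat using (ℕ; zero; suc; _%_; _≡ᵇ_; NonZero)
open import Data.Nat.Base using (∣_-_∣)
open import Data.Fin using (Fin; toℕ)
open import Data.Fin.Properties using (_≟_)
open import Data.List using (List; []; _∷_; filter)
open import Data.Product using (∃; _×_; Σ)
open import Data.Sum using (_⊎_)
open import Relation.Binary.PropositionalEquality using (_≡_)
open import Relation.Nullary using (¬_; Dec)
open import Relation.Unary using (Pred)
open import Relation.Nullary.Decidable using (_⊎-dec_)
open import Function.Bundles using (_⇔_)
open import Level using (0ℓ)

-- A simple graph on vertex set Fin n, given by its adjacency relation.
-- Vertex i : Fin n stands for the integer (toℕ i + 1) ∈ [n].
Graph : ℕ → Set₁
Graph n = Fin n → Fin n → Set

-- Toeplitz graph G_n(1^{k-1} 0 1^{m-k}): distinct x, y adjacent iff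
-- |x - y| is not congruent to k modulo m.
ToeplitzSingleZero : (n k m : ℕ) → .{{NonZero m}} → Graph n
ToeplitzSingleZero n k m x y =
  ¬ (x ≡ y) × ¬ (∣ toℕ x - toℕ y ∣ % m ≡ k % m)

altWord : {A : Set} → A → A → ℕ → List A
altWord a b zero = []
altWord a b (suc l) = a ∷ altWord b a l

restrict : {n : ℕ} → List (Fin n) → Fin n → Fin n → List (Fin n)
restrict w x y = filter (λ z → (z ≟ x) ⊎-dec (z ≟ y)) w

Alternate : {n : ℕ} → List (Fin n) → Fin n → Fin n → Set
Alternate w x y =
  ∃ λ l → (restrict w x y ≡ altWord x y l) ⊎ (restrict w x y ≡ altWord y x l)

WordRepresentable : {n : ℕ} → Graph n → Set
WordRepresentable {n} G =
  ∃ λ (w : List (Fin n)) → (x y : Fin n) → ¬ (x ≡ y) → (Alternate w x y ⇔ G x y)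

module Submission where

-- Every vertex v gets a class κ(v) < m and every class r an increasing list P(r) of positions;
-- the word lists, position after position, the vertices whose class occupies that position.
-- Restricted to two vertices x < y it is the merge of P(κ(x)) and P(κ(y)) with ties going to x,
-- so whether x and y alternate is a property of their two classes.
-- For m = 2k take κ(v) = v mod m; then x < y are non-adjacent iff κ(y) = κ(x) + k (mod m).
-- Class s < k gets the positions 2s, 2(k+s)+1 and class k+s gets 2s+1, 2(k+s): exactly the
-- pairs {s, k+s} are nested, all other pairs cross.
-- For gcd(k, m) = 1 take κ(v) = cv mod m with ck ≡ -1 (mod m); then x < y are non-adjacent iff
-- κ(x) = κ(y) + 1 (mod m).  Class u gets the staircase ⌊u/2⌋, ⌈u/2⌉ + ⌊m/2⌋, in which consecutive
-- classes share a position; the tie makes u and u + 1 interleave in one order but not in the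
-- other.  Only for even m does class 0 need a third position to close the cycle.

open import Defs
open import Data.Bool using (Bool; true; false; not; if_then_else_)
open import Data.Fin using (Fin; toℕ) renaming (zero to fzero; suc to fsuc)
import Data.Fin.Properties as Fin
open import Data.List using (List; []; _∷_; _++_; filter; map; allFin)
open import Data.List.Properties using (∷-injectiveˡ; ∷-injectiveʳ; filter-≐; filter-++; map-tabulate; ++-assoc)
open import Data.List.Relation.Unary.All as All using (All; []; _∷_)
open import Data.List.Relation.Unary.All.Properties using (++⁻ʳ)
open import Data.List.Relation.Unary.Any using (here; there)
open import Data.List.Membership.Propositional using (_∈_; _∉_)
open import Data.Nat
open import Data.Nat.Properties
open import Data.List.Membership.DecPropositional _≟_ using (_∈?_)
open import Data.Nat.DivMod using (%-distribˡ-+; %-distribˡ-*; m%n%n≡m%n; [m+n]%n≡m%n; m*n%n≡0; n%n≡0; m<n⇒m%n≡m; m%n<n)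
open import Data.Nat.GCD using (gcd; gcd-GCD; GCD; module Bézout)
open import Data.Nat.Tactic.RingSolver using (solve-∀)
open import Data.Product using (∃; ∃₂; _×_; _,_)
open import Data.Sum as Sum using (_⊎_; inj₁; inj₂; swap)
open import Function using (id; _∘_; flip; const)
open import Function.Bundles using (_⇔_; mk⇔; Equivalence)
open import Function.Properties.Equivalence using () renaming (trans to ⇔-trans)
open import Level using (0ℓ)
open import Relation.Binary using (tri<; tri≈; tri>)
open import Relation.Binary.Bundles using (Setoid)
import Relation.Binary.Construct.On as On
import Relation.Binary.Reasoning.Setoid as SetoidReasoning
open import Relation.Binary.PropositionalEquality
open import Relation.Nullary using (¬_; yes; no; does; contradiction)
open import Relation.Nullary.Decidable using (dec-true; dec-false; does-⇔)
open import Relation.Unary using (Pred; Decidable)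

-- Restriction to two letters

keepIf : {A : Set} → Bool → A → List A
keepIf true  a = a ∷ []
keepIf false a = []

filter-pair : {A : Set} {Q : Pred A 0ℓ} (Q? : Decidable Q) (x y : A)
            → filter Q? (x ∷ y ∷ []) ≡ keepIf (does (Q? x)) x ++ keepIf (does (Q? y)) y
filter-pair Q? x y with does (Q? x) | does (Q? y) in qy
... | true  | true  rewrite qy = refl
... | true  | false rewrite qy = refl
... | false | true  rewrite qy = refl
... | false | false rewrite qy = refl

filter-comm : {A : Set} {P Q : Pred A 0ℓ} (P? : Decidable P) (Q? : Decidable Q) (xs : List A)
            → filter P? (filter Q? xs) ≡ filter Q? (filter P? xs)
filter-comm P? Q? [] = refl
filter-comm P? Q? (z ∷ zs) with does (P? z) in p | does (Q? z) in q
... | true  | true  rewrite p | q = cong (z ∷_) (filter-comm P? Q? zs)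
... | true  | false rewrite q = filter-comm P? Q? zs
... | false | true  rewrite p = filter-comm P? Q? zs
... | false | false = filter-comm P? Q? zs

filter-map : {A B : Set} {P : Pred A 0ℓ} (P? : Decidable P) (f : B → A) (xs : List B)
           → filter P? (map f xs) ≡ map f (filter (λ z → P? (f z)) xs)
filter-map P? f [] = refl
filter-map P? f (z ∷ zs) with does (P? (f z))
... | true  = cong (f z ∷_) (filter-map P? f zs)
... | false = filter-map P? f zs

allFin-suc : ∀ N → allFin (suc N) ≡ fzero ∷ map fsuc (allFin N)
allFin-suc N = cong (fzero ∷_) (sym (map-tabulate id fsuc))

module _ {N : ℕ} where

  restrict-map-suc : (l : List (Fin N)) (x y : Fin N)
                   → restrict (map fsuc l) (fsuc x) (fsuc y) ≡ map fsuc (restrict l x y)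
  restrict-map-suc l x y = trans (filter-map _ fsuc l) (cong (map fsuc) (filter-≐ _ _ (peel , grow) l))
    where
    peel : ∀ {z} → fsuc z ≡ fsuc x ⊎ fsuc z ≡ fsuc y → z ≡ x ⊎ z ≡ y
    peel = Sum.map Fin.suc-injective Fin.suc-injective
    grow : ∀ {z} → z ≡ x ⊎ z ≡ y → fsuc z ≡ fsuc x ⊎ fsuc z ≡ fsuc y
    grow = Sum.map (cong fsuc) (cong fsuc)

  restrict-map-zero-suc : (l : List (Fin N)) (y : Fin N)
                        → restrict (map fsuc l) fzero (fsuc y) ≡ map fsuc (restrict l y y)
  restrict-map-zero-suc l y = trans (filter-map _ fsuc l) (cong (map fsuc) (filter-≐ _ _ (peel , grow) l))
    where
    peel : ∀ {z} → fsuc z ≡ fzero ⊎ fsuc z ≡ fsuc y → z ≡ y ⊎ z ≡ y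
    peel (inj₂ e) = inj₂ (Fin.suc-injective e)
    grow : ∀ {z} → z ≡ y ⊎ z ≡ y → fsuc z ≡ fzero ⊎ fsuc z ≡ fsuc y
    grow = inj₂ ∘ cong fsuc ∘ Sum.[ id , id ]

  restrict-map-zero-zero : (l : List (Fin N)) → restrict (map fsuc l) fzero fzero ≡ []
  restrict-map-zero-zero []      = refl
  restrict-map-zero-zero (_ ∷ l) = restrict-map-zero-zero l

restrict-allFin-suc : ∀ {N} (x y : Fin (suc N))
                    → restrict (allFin (suc N)) x y ≡ restrict (fzero ∷ map fsuc (allFin N)) x y
restrict-allFin-suc {N} x y = cong (λ l → restrict l x y) (allFin-suc N)

restrict-allFin-self : ∀ {N} (x : Fin N) → restrict (allFin N) x x ≡ x ∷ []
restrict-allFin-self {suc N} fzero = trans (restrict-allFin-suc fzero fzero)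
  (cong (fzero ∷_) (restrict-map-zero-zero (allFin N)))
restrict-allFin-self {suc N} (fsuc x) = trans (restrict-allFin-suc (fsuc x) (fsuc x))
  (trans (restrict-map-suc (allFin N) x x) (cong (map fsuc) (restrict-allFin-self x)))

restrict-allFin : ∀ {N} (x y : Fin N) → toℕ x < toℕ y → restrict (allFin N) x y ≡ x ∷ y ∷ []
restrict-allFin {suc N} fzero (fsuc y) _ = trans (restrict-allFin-suc fzero (fsuc y))
  (cong (fzero ∷_) (trans (restrict-map-zero-suc (allFin N) y) (cong (map fsuc) (restrict-allFin-self y))))
restrict-allFin {suc N} (fsuc x) (fsuc y) (s≤s x<y) = trans (restrict-allFin-suc (fsuc x) (fsuc y))
  (trans (restrict-map-suc (allFin N) x y) (cong (map fsuc) (restrict-allFin x y x<y)))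

restrict-comm : ∀ {N} (w : List (Fin N)) (x y : Fin N) → restrict w x y ≡ restrict w y x
restrict-comm w x y = filter-≐ _ _ (swap , swap) w

Alternating : {A : Set} → A → A → List A → Set
Alternating x y s = ∃ λ l → s ≡ altWord x y l ⊎ s ≡ altWord y x l

alternating-comm : {A : Set} {x y : A} {s : List A} → Alternating x y s → Alternating y x s
alternating-comm (l , e) = l , swap e

HasRepeat : {A : Set} → List A → Set
HasRepeat {A} s = ∃₂ λ (p q : List A) → ∃ λ z → s ≡ p ++ z ∷ z ∷ q

altWord-no-repeat : {A : Set} {x y : A} → ¬ x ≡ y → ∀ l → ¬ HasRepeat (altWord x y l)
altWord-no-repeat x≢y (suc (suc l)) ([] , q , z , e) = x≢y (trans (∷-injectiveˡ e) (sym (∷-injectiveˡ (∷-injectiveʳ e))))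
altWord-no-repeat x≢y (suc l) (_ ∷ p , q , z , e) =
  altWord-no-repeat (x≢y ∘ sym) l (p , q , z , ∷-injectiveʳ e)

alternating-no-repeat : {A : Set} {x y : A} {s : List A} → ¬ x ≡ y → Alternating x y s → ¬ HasRepeat s
alternating-no-repeat x≢y (l , inj₁ refl) = altWord-no-repeat x≢y l
alternating-no-repeat x≢y (l , inj₂ refl) = altWord-no-repeat (x≢y ∘ sym) l

module _ {n : ℕ} (G : Graph n) (G-sym : ∀ x y → G x y → G y x) (w : List (Fin n))
  (classify : ∀ x y → toℕ x < toℕ y →
     (¬ G x y × HasRepeat (restrict w x y)) ⊎ (G x y × Alternating x y (restrict w x y))) where

  private
    represents-< : ∀ x y → ¬ x ≡ y → toℕ x < toℕ y → Alternate w x y ⇔ G x y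
    represents-< x y x≢y x<y with classify x y x<y
    ... | inj₁ (¬G , repeat) = mk⇔ (λ alt → contradiction repeat (alternating-no-repeat x≢y alt)) (flip contradiction ¬G)
    ... | inj₂ (g , alt)     = mk⇔ (const g) (const alt)

    represents : ∀ x y → ¬ x ≡ y → Alternate w x y ⇔ G x y
    represents x y x≢y with <-cmp (toℕ x) (toℕ y)
    ... | tri< x<y _ _ = represents-< x y x≢y x<y
    ... | tri≈ _ x≡y _ = contradiction (Fin.toℕ-injective x≡y) x≢y
    ... | tri> _ _ y<x = mk⇔
      (G-sym y x ∘ Equivalence.to yx ∘ subst (Alternating y x) (restrict-comm w x y) ∘ alternating-comm)
      (subst (Alternating x y) (restrict-comm w y x) ∘ alternating-comm ∘ Equivalence.from yx ∘ G-sym x y)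
      where yx = represents-< y x (x≢y ∘ sym) y<x

  wordRepresentable-from-ordered-pairs : WordRepresentable G
  wordRepresentable-from-ordered-pairs = w , represents

-- Merging position lists

concatFrom : {A : Set} → (ℕ → List A) → ℕ → ℕ → List A
concatFrom T a zero    = []
concatFrom T a (suc l) = T a ++ concatFrom T (suc a) l

concatFrom-cong : {A : Set} {T U : ℕ → List A} (a l : ℕ) → (∀ j → a ≤ j → T j ≡ U j)
                → concatFrom T a l ≡ concatFrom U a l
concatFrom-cong a zero    T≗U = refl
concatFrom-cong a (suc l) T≗U = cong₂ _++_ (T≗U a ≤-refl) (concatFrom-cong (suc a) l (λ j a<j → T≗U j (<⇒≤ a<j)))

data AscendingFrom : ℕ → List ℕ → Set where
  []  : ∀ {a} → AscendingFrom a []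
  _∷_ : ∀ {a p ps} → a ≤ p → AscendingFrom (suc p) ps → AscendingFrom a (p ∷ ps)

ascendingFrom-weaken : ∀ {a b ps} → a ≤ b → AscendingFrom b ps → AscendingFrom a ps
ascendingFrom-weaken a≤b []            = []
ascendingFrom-weaken a≤b (b≤p ∷ ascPs) = ≤-trans a≤b b≤p ∷ ascPs

ascendingFrom-∉ : ∀ {a ps} → AscendingFrom (suc a) ps → a ∉ ps
ascendingFrom-∉ (a<p ∷ _)     (here refl)  = <-irrefl refl a<p
ascendingFrom-∉ (a<p ∷ ascPs) (there a∈ps) = ascendingFrom-∉ (ascendingFrom-weaken (≤-trans a<p (n≤1+n _)) ascPs) a∈ps

splitHead : ∀ {a ps} → AscendingFrom a ps
          → ∃₂ λ b rest → ps ≡ keepIf b a ++ rest × AscendingFrom (suc a) rest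
splitHead []              = false , [] , refl , []
splitHead (a≤p ∷ ascPs) with m≤n⇒m<n∨m≡n a≤p
... | inj₁ a<p  = false , _ , refl , a<p ∷ ascPs
... | inj₂ refl = true , _ , refl , ascPs

module Merge {A : Set} (x y : A) where

  merge : List ℕ → List ℕ → List A
  merge []       []       = []
  merge []       (q ∷ qs) = y ∷ merge [] qs
  merge (p ∷ ps) []       = x ∷ merge ps []
  merge (p ∷ ps) (q ∷ qs) = if p ≤ᵇ q then x ∷ merge ps (q ∷ qs) else y ∷ merge (p ∷ ps) qs

  merge-≤ : ∀ {p q} ps qs → p ≤ q → merge (p ∷ ps) (q ∷ qs) ≡ x ∷ merge ps (q ∷ qs)
  merge-≤ {p} {q} ps qs p≤q with p ≤ᵇ q | ≤⇒≤ᵇ p≤q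
  ... | true | _ = refl

  merge-> : ∀ {p q} ps qs → q < p → merge (p ∷ ps) (q ∷ qs) ≡ y ∷ merge (p ∷ ps) qs
  merge-> {p} {q} ps qs q<p with p ≤ᵇ q | ≤ᵇ⇒≤ p q
  ... | true  | p≤q = contradiction q<p (≤⇒≯ (p≤q _))
  ... | false | _   = refl

  merge-head-x : ∀ {a} ps {qs} → AscendingFrom (suc a) qs → merge (a ∷ ps) qs ≡ x ∷ merge ps qs
  merge-head-x ps []        = refl
  merge-head-x ps (a<q ∷ _) = merge-≤ ps _ (<⇒≤ a<q)

  merge-head-y : ∀ {a ps} qs → AscendingFrom (suc a) ps → merge ps (a ∷ qs) ≡ y ∷ merge ps qs
  merge-head-y qs []        = refl
  merge-head-y qs (a<p ∷ _) = merge-> _ qs a<p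

  merge-keepIf : ∀ b c {a ps qs} → AscendingFrom (suc a) ps → AscendingFrom (suc a) qs
               → merge (keepIf b a ++ ps) (keepIf c a ++ qs) ≡ keepIf b x ++ keepIf c y ++ merge ps qs
  merge-keepIf true  true  {ps = ps} {qs} ascPs _ = trans (merge-≤ ps qs ≤-refl) (cong (x ∷_) (merge-head-y qs ascPs))
  merge-keepIf true  false {ps = ps}      _ ascQs = merge-head-x ps ascQs
  merge-keepIf false true  {qs = qs}  ascPs _     = merge-head-y qs ascPs
  merge-keepIf false false              _ _     = refl

  slot : List ℕ → List ℕ → ℕ → List A
  slot ps qs j = keepIf (does (j ∈? ps)) x ++ keepIf (does (j ∈? qs)) y

  ∈?-keepIf-here : ∀ b {a ps} → AscendingFrom (suc a) ps → does (a ∈? (keepIf b a ++ ps)) ≡ b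
  ∈?-keepIf-here true {a} {ps} ascPs = dec-true (a ∈? a ∷ ps) (here refl)
  ∈?-keepIf-here false ascPs = dec-false (_ ∈? _) (ascendingFrom-∉ ascPs)

  ∈?-keepIf-later : ∀ b {a j} ps → a < j → does (j ∈? (keepIf b a ++ ps)) ≡ does (j ∈? ps)
  ∈?-keepIf-later true  ps a<j = does-⇔ (mk⇔ drop there) (_ ∈? _) (_ ∈? _)
    where
    drop : _ ∈ _ ∷ ps → _ ∈ ps
    drop (here refl)  = contradiction a<j (<-irrefl refl)
    drop (there j∈ps) = j∈ps
  ∈?-keepIf-later false ps a<j = refl

  module _ (b c : Bool) {a : ℕ} {ps qs : List ℕ} where

    slot-here : AscendingFrom (suc a) ps → AscendingFrom (suc a) qs
              → slot (keepIf b a ++ ps) (keepIf c a ++ qs) a ≡ keepIf b x ++ keepIf c y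
    slot-here ascPs ascQs = cong₂ (λ u v → keepIf u x ++ keepIf v y) (∈?-keepIf-here b ascPs) (∈?-keepIf-here c ascQs)

    slot-later : ∀ {j} → a < j → slot (keepIf b a ++ ps) (keepIf c a ++ qs) j ≡ slot ps qs j
    slot-later a<j = cong₂ (λ u v → keepIf u x ++ keepIf v y) (∈?-keepIf-later b ps a<j) (∈?-keepIf-later c qs a<j)

  concatFrom-slot : ∀ l a {ps qs} → AscendingFrom a ps → AscendingFrom a qs
                  → All (_< l + a) ps → All (_< l + a) qs → concatFrom (slot ps qs) a l ≡ merge ps qs
  concatFrom-slot zero a []        []        _         _         = refl
  concatFrom-slot zero a (a≤p ∷ _) _         (p<a ∷ _) _         = contradiction (≤-<-trans a≤p p<a) (<-irrefl refl)
  concatFrom-slot zero a []        (a≤q ∷ _) _         (q<a ∷ _) = contradiction (≤-<-trans a≤q q<a) (<-irrefl refl)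
  concatFrom-slot (suc l) a ascPs ascQs boundPs boundQs
    with splitHead ascPs | splitHead ascQs
  ... | b , ps , refl , ascPs′ | c , qs , refl , ascQs′ = begin
    slot (keepIf b a ++ ps) (keepIf c a ++ qs) a ++ concatFrom (slot (keepIf b a ++ ps) (keepIf c a ++ qs)) (suc a) l
      ≡⟨ cong₂ _++_ (slot-here b c ascPs′ ascQs′) (concatFrom-cong (suc a) l (λ _ → slot-later b c)) ⟩
    (keepIf b x ++ keepIf c y) ++ concatFrom (slot ps qs) (suc a) l
      ≡⟨ ++-assoc (keepIf b x) _ _ ⟩
    keepIf b x ++ keepIf c y ++ concatFrom (slot ps qs) (suc a) l
      ≡⟨ cong (λ s → keepIf b x ++ keepIf c y ++ s)
              (concatFrom-slot l (suc a) ascPs′ ascQs′ (shift (++⁻ʳ (keepIf b a) boundPs)) (shift (++⁻ʳ (keepIf c a) boundQs))) ⟩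
    keepIf b x ++ keepIf c y ++ merge ps qs
      ≡⟨ merge-keepIf b c ascPs′ ascQs′ ⟨
    merge (keepIf b a ++ ps) (keepIf c a ++ qs) ∎
    where
    open ≡-Reasoning
    shift : ∀ {rs} → All (_< suc l + a) rs → All (_< l + suc a) rs
    shift = All.map (λ {r} r<U → subst (r <_) (sym (+-suc l a)) r<U)

  merge-self : ∀ {a ps} → AscendingFrom a ps → ∃ λ l → merge ps ps ≡ altWord x y l
  merge-self [] = 0 , refl
  merge-self {ps = p ∷ ps} (_ ∷ ascPs) with merge-self ascPs
  ... | l , e = suc (suc l) , trans (merge-≤ ps ps ≤-refl) (cong (x ∷_) (trans (merge-head-y ps ascPs) (cong (y ∷_) e)))

  module _ {p₁ p₂ q₁ q₂ : ℕ} where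

    merge-xyxy : p₁ ≤ q₁ → q₁ < p₂ → p₂ ≤ q₂ → merge (p₁ ∷ p₂ ∷ []) (q₁ ∷ q₂ ∷ []) ≡ x ∷ y ∷ x ∷ y ∷ []
    merge-xyxy h₁ h₂ h₃ = trans (merge-≤ (p₂ ∷ []) (q₂ ∷ []) h₁)
      (cong (x ∷_) (trans (merge-> [] (q₂ ∷ []) h₂) (cong (y ∷_) (merge-≤ [] [] h₃))))

    merge-yxyx : q₁ < p₁ → p₁ ≤ q₂ → q₂ < p₂ → merge (p₁ ∷ p₂ ∷ []) (q₁ ∷ q₂ ∷ []) ≡ y ∷ x ∷ y ∷ x ∷ []
    merge-yxyx h₁ h₂ h₃ = trans (merge-> (p₂ ∷ []) (q₂ ∷ []) h₁)
      (cong (y ∷_) (trans (merge-≤ (p₂ ∷ []) [] h₂) (cong (x ∷_) (merge-> [] [] h₃))))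

    merge-xyyx : p₁ ≤ q₁ → q₁ < q₂ → q₂ < p₂ → merge (p₁ ∷ p₂ ∷ []) (q₁ ∷ q₂ ∷ []) ≡ x ∷ y ∷ y ∷ x ∷ []
    merge-xyyx h₁ h₂ h₃ = trans (merge-≤ (p₂ ∷ []) (q₂ ∷ []) h₁)
      (cong (x ∷_) (trans (merge-> [] (q₂ ∷ []) (<-trans h₂ h₃)) (cong (y ∷_) (merge-> [] [] h₃))))

    merge-yxxy : q₁ < p₁ → p₁ < p₂ → p₂ ≤ q₂ → merge (p₁ ∷ p₂ ∷ []) (q₁ ∷ q₂ ∷ []) ≡ y ∷ x ∷ x ∷ y ∷ []
    merge-yxxy h₁ h₂ h₃ = trans (merge-> (p₂ ∷ []) (q₂ ∷ []) h₁)
      (cong (y ∷_) (trans (merge-≤ (p₂ ∷ []) [] (<⇒≤ (<-≤-trans h₂ h₃))) (cong (x ∷_) (merge-≤ [] [] h₃))))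

    merge-xxyy : p₁ < p₂ → p₂ ≤ q₁ → merge (p₁ ∷ p₂ ∷ []) (q₁ ∷ q₂ ∷ []) ≡ x ∷ x ∷ y ∷ y ∷ []
    merge-xxyy h₁ h₂ = trans (merge-≤ (p₂ ∷ []) (q₂ ∷ []) (<⇒≤ (<-≤-trans h₁ h₂)))
      (cong (x ∷_) (merge-≤ [] (q₂ ∷ []) h₂))

  module _ {p₁ p₂ p₃ q₁ q₂ : ℕ} where

    merge-xyxyx : p₁ ≤ q₁ → q₁ < p₂ → p₂ ≤ q₂ → q₂ < p₃
                → merge (p₁ ∷ p₂ ∷ p₃ ∷ []) (q₁ ∷ q₂ ∷ []) ≡ x ∷ y ∷ x ∷ y ∷ x ∷ []
    merge-xyxyx h₁ h₂ h₃ h₄ = trans (merge-≤ (p₂ ∷ p₃ ∷ []) (q₂ ∷ []) h₁) (cong (x ∷_)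
      (trans (merge-> (p₃ ∷ []) (q₂ ∷ []) h₂) (cong (y ∷_)
      (trans (merge-≤ (p₃ ∷ []) [] h₃) (cong (x ∷_) (merge-> [] [] h₄))))))

    merge-xyxxy : p₁ ≤ q₁ → q₁ < p₂ → p₂ < p₃ → p₃ ≤ q₂
                → merge (p₁ ∷ p₂ ∷ p₃ ∷ []) (q₁ ∷ q₂ ∷ []) ≡ x ∷ y ∷ x ∷ x ∷ y ∷ []
    merge-xyxxy h₁ h₂ h₃ h₄ = trans (merge-≤ (p₂ ∷ p₃ ∷ []) (q₂ ∷ []) h₁) (cong (x ∷_)
      (trans (merge-> (p₃ ∷ []) (q₂ ∷ []) h₂) (cong (y ∷_)
      (trans (merge-≤ (p₃ ∷ []) [] (<⇒≤ (<-≤-trans h₃ h₄))) (cong (x ∷_) (merge-≤ [] [] h₄))))))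

  module _ {p₁ p₂ q₁ q₂ q₃ : ℕ} where

    merge-yxyxy : q₁ < p₁ → p₁ ≤ q₂ → q₂ < p₂ → p₂ ≤ q₃
                → merge (p₁ ∷ p₂ ∷ []) (q₁ ∷ q₂ ∷ q₃ ∷ []) ≡ y ∷ x ∷ y ∷ x ∷ y ∷ []
    merge-yxyxy h₁ h₂ h₃ h₄ = trans (merge-> (p₂ ∷ []) (q₂ ∷ q₃ ∷ []) h₁) (cong (y ∷_)
      (trans (merge-≤ (p₂ ∷ []) (q₃ ∷ []) h₂) (cong (x ∷_)
      (trans (merge-> [] (q₃ ∷ []) h₃) (cong (y ∷_) (merge-≤ [] [] h₄))))))

    merge-xyyxy : p₁ ≤ q₁ → q₁ < q₂ → q₂ < p₂ → p₂ ≤ q₃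
                → merge (p₁ ∷ p₂ ∷ []) (q₁ ∷ q₂ ∷ q₃ ∷ []) ≡ x ∷ y ∷ y ∷ x ∷ y ∷ []
    merge-xyyxy h₁ h₂ h₃ h₄ = trans (merge-≤ (p₂ ∷ []) (q₂ ∷ q₃ ∷ []) h₁) (cong (x ∷_)
      (trans (merge-> [] (q₂ ∷ q₃ ∷ []) (<-trans h₂ h₃)) (cong (y ∷_)
      (trans (merge-> [] (q₃ ∷ []) h₃) (cong (y ∷_) (merge-≤ [] [] h₄))))))

-- Words built from positions

module _ {N : ℕ} (x y : Fin N) where

  restrict-concatFrom : (T : ℕ → List (Fin N)) (a l : ℕ)
                      → restrict (concatFrom T a l) x y ≡ concatFrom (λ j → restrict (T j) x y) a l
  restrict-concatFrom T a zero    = refl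
  restrict-concatFrom T a (suc l) =
    trans (filter-++ _ (T a) _) (cong (restrict (T a) x y ++_) (restrict-concatFrom T (suc a) l))

  restrict-filter-allFin : {Q : Pred (Fin N) 0ℓ} (Q? : Decidable Q) → toℕ x < toℕ y
                         → restrict (filter Q? (allFin N)) x y ≡ keepIf (does (Q? x)) x ++ keepIf (does (Q? y)) y
  restrict-filter-allFin Q? x<y =
    trans (filter-comm _ Q? (allFin N)) (trans (cong (filter Q?) (restrict-allFin x y x<y)) (filter-pair Q? x y))

positionWord : {n : ℕ} → (Fin n → List ℕ) → ℕ → List (Fin n)
positionWord {n} pos L = concatFrom (λ j → filter (λ v → j ∈? pos v) (allFin n)) 0 L

restrict-positionWord : {n : ℕ} (pos : Fin n → List ℕ) (L : ℕ)
  → (∀ v → AscendingFrom 0 (pos v)) → (∀ v → All (_< L) (pos v))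
  → ∀ x y → toℕ x < toℕ y → restrict (positionWord pos L) x y ≡ Merge.merge x y (pos x) (pos y)
restrict-positionWord pos L asc bound x y x<y =
  trans (restrict-concatFrom x y _ 0 L)
  (trans (concatFrom-cong 0 L (λ j _ → restrict-filter-allFin x y (λ v → j ∈? pos v) x<y))
         (Merge.concatFrom-slot x y L 0 (asc x) (asc y) (fit (bound x)) (fit (bound y))))
  where
  fit : ∀ {ps} → All (_< L) ps → All (_< L + 0) ps
  fit = All.map (λ {r} r<L → subst (r <_) (sym (+-identityʳ L)) r<L)

Classified : {A : Set} → A → A → Set → List A → Set
Classified x y C s = (C × HasRepeat s) ⊎ (¬ C × Alternating x y s)

record PositionScheme (k m : ℕ) .{{_ : NonZero m}} : Set₁ where
  field
    class     : ℕ → ℕ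
    class<    : ∀ v → class v < m
    positions : ℕ → List ℕ
    width     : ℕ
    ascending : ∀ r → r < m → AscendingFrom 0 (positions r)
    bounded   : ∀ r → r < m → All (_< width) (positions r)
    Conflict  : ℕ → ℕ → Set
    conflict⇔ : ∀ {u v} → u < v → (∣ u - v ∣ % m ≡ k % m) ⇔ Conflict (class u) (class v)
    classify  : ∀ {A : Set} (x y : A) r s → r < m → s < m
              → Classified x y (Conflict r s) (Merge.merge x y (positions r) (positions s))

module _ {k m : ℕ} .{{_ : NonZero m}} (S : PositionScheme k m) (n : ℕ) where
  open PositionScheme S

  private
    G = ToeplitzSingleZero n k m

    G-sym : ∀ x y → G x y → G y x
    G-sym x y (x≢y , ¬c) = x≢y ∘ sym , ¬c ∘ trans (cong (_% m) (∣-∣-comm (toℕ x) (toℕ y)))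

    vertexPositions : Fin n → List ℕ
    vertexPositions = positions ∘ class ∘ toℕ

    word : List (Fin n)
    word = positionWord vertexPositions width

    classifyPair : ∀ x y → toℕ x < toℕ y
                 → (¬ G x y × HasRepeat (restrict word x y)) ⊎ (G x y × Alternating x y (restrict word x y))
    classifyPair x y x<y
      rewrite restrict-positionWord vertexPositions width (λ v → ascending _ (class< (toℕ v)))
                (λ v → bounded _ (class< (toℕ v))) x y x<y
      with classify x y (class (toℕ x)) (class (toℕ y)) (class< _) (class< _)
    ... | inj₁ (c , repeat) = inj₁ ((λ (_ , ¬d) → ¬d (Equivalence.from (conflict⇔ x<y) c)) , repeat)
    ... | inj₂ (¬c , alt)   = inj₂ (((λ { refl → <-irrefl refl x<y }) , ¬c ∘ Equivalence.to (conflict⇔ x<y)) , alt)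

  scheme⇒wordRepresentable : WordRepresentable (ToeplitzSingleZero n k m)
  scheme⇒wordRepresentable = wordRepresentable-from-ordered-pairs G G-sym word classifyPair

-- Congruences modulo m

module Congruence (m : ℕ) .{{_ : NonZero m}} where

  infix 4 _≈_
  _≈_ : ℕ → ℕ → Set
  a ≈ b = a % m ≡ b % m

  ≈-setoid : Setoid 0ℓ 0ℓ
  ≈-setoid = On.setoid (setoid ℕ) (_% m)

  open Setoid ≈-setoid public using () renaming (refl to ≈-refl; sym to ≈-sym; trans to ≈-trans)
  module ≈-Reasoning = SetoidReasoning ≈-setoid

  ≡⇒≈ : ∀ {a b} → a ≡ b → a ≈ b
  ≡⇒≈ = cong (_% m)

  ≈-% : ∀ a → a % m ≈ a
  ≈-% a = m%n%n≡m%n a m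

  ≈-+ : ∀ {a b c d} → a ≈ b → c ≈ d → a + c ≈ b + d
  ≈-+ {a} {b} {c} {d} a≈b c≈d = begin
    (a + c) % m           ≡⟨ %-distribˡ-+ a c m ⟩
    (a % m + c % m) % m   ≡⟨ cong₂ (λ u v → (u + v) % m) a≈b c≈d ⟩
    (b % m + d % m) % m   ≡⟨ %-distribˡ-+ b d m ⟨
    (b + d) % m           ∎
    where open ≡-Reasoning

  ≈-* : ∀ {a b c d} → a ≈ b → c ≈ d → a * c ≈ b * d
  ≈-* {a} {b} {c} {d} a≈b c≈d = begin
    (a * c) % m             ≡⟨ %-distribˡ-* a c m ⟩
    (a % m * (c % m)) % m   ≡⟨ cong₂ (λ u v → (u * v) % m) a≈b c≈d ⟩
    (b % m * (d % m)) % m   ≡⟨ %-distribˡ-* b d m ⟨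
    (b * d) % m             ∎
    where open ≡-Reasoning

  *m≈0 : ∀ a → a * m ≈ 0
  *m≈0 a = trans (m*n%n≡0 a m) (sym (m*n%n≡0 0 m))

  m≈0 : m ≈ 0
  m≈0 = trans (n%n≡0 m) (sym (m*n%n≡0 0 m))

  suc-cancel-≈ : ∀ {a b} → suc a ≈ suc b → a ≈ b
  suc-cancel-≈ {a} {b} sa≈sb = begin
    a                ≈⟨ [m+n]%n≡m%n a m ⟨
    a + m            ≡⟨ shift a ⟩
    suc a + pred m   ≈⟨ ≈-+ sa≈sb (≈-refl {pred m}) ⟩
    suc b + pred m   ≡⟨ shift b ⟨
    b + m            ≈⟨ [m+n]%n≡m%n b m ⟩
    b                ∎
    where
    open ≈-Reasoning
    shift : ∀ c → c + m ≡ suc c + pred m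
    shift c = trans (cong (c +_) (sym (suc-pred m))) (+-suc c (pred m))

  +-cancelˡ-≈ : ∀ a {b c} → a + b ≈ a + c → b ≈ c
  +-cancelˡ-≈ zero    b≈c = b≈c
  +-cancelˡ-≈ (suc a) e   = +-cancelˡ-≈ a (suc-cancel-≈ e)

  ∣-∣≈⇔ : ∀ {u v} k → u ≤ v → ∣ u - v ∣ ≈ k ⇔ v ≈ u + k
  ∣-∣≈⇔ {u} {v} k u≤v = mk⇔
    (λ d≈k → ≈-trans (≡⇒≈ (sym split)) (≈-+ (≈-refl {u}) (≈-trans (≡⇒≈ (sym d≡)) d≈k)))
    (λ v≈u+k → ≈-trans (≡⇒≈ d≡) (+-cancelˡ-≈ u (≈-trans (≡⇒≈ split) v≈u+k)))
    where
    d≡ : ∣ u - v ∣ ≡ v ∸ u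
    d≡ = m≤n⇒∣m-n∣≡n∸m u≤v
    split : u + (v ∸ u) ≡ v
    split = m+[n∸m]≡n u≤v

  negativeInverse : ∀ {k} → gcd k m ≡ 1 → ∃ λ c → c * k + 1 ≈ 0
  negativeInverse {k} gcd≡1 with Bézout.identity (subst (GCD k m) gcd≡1 (gcd-GCD k m))
  ... | Bézout.-+ a b 1+ak≡bm = a , (begin
    a * k + 1   ≡⟨ trans (+-comm (a * k) 1) 1+ak≡bm ⟩
    b * m       ≈⟨ *m≈0 b ⟩
    0           ∎)
    where open ≈-Reasoning
  ... | Bézout.+- a b 1+bm≡ak = a * pred m , (begin
    a * pred m * k + 1   ≡⟨ cong (_+ 1) (reorder a (pred m) k) ⟩
    pred m * (a * k) + 1 ≈⟨ ≈-+ (≈-* (≈-refl {pred m}) ak≈1) (≈-refl {1}) ⟩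
    pred m * 1 + 1       ≡⟨ trans (+-comm (pred m * 1) 1) (cong suc (*-identityʳ (pred m))) ⟩
    suc (pred m)         ≡⟨ suc-pred m ⟩
    m                    ≈⟨ m≈0 ⟩
    0                    ∎)
    where
    open ≈-Reasoning
    reorder : ∀ a p k → a * p * k ≡ p * (a * k)
    reorder = solve-∀
    ak≈1 : a * k ≈ 1
    ak≈1 = begin
      a * k       ≡⟨ 1+bm≡ak ⟨
      1 + b * m   ≈⟨ ≈-+ (≈-refl {1}) (*m≈0 b) ⟩
      1 + 0       ∎

  module _ {c k : ℕ} (inverse : c * k + 1 ≈ 0) where

    ≈+k⇔*-inverse : ∀ {u v} → v ≈ u + k ⇔ u * c ≈ suc (v * c)
    ≈+k⇔*-inverse {u} {v} = mk⇔ to from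
      where
      to : v ≈ u + k → u * c ≈ suc (v * c)
      to v≈u+k = begin
        u * c                  ≡⟨ +-identityʳ (u * c) ⟨
        u * c + 0              ≈⟨ ≈-+ (≈-refl {u * c}) inverse ⟨
        u * c + (c * k + 1)    ≡⟨ identity u k c ⟩
        suc ((u + k) * c)      ≈⟨ ≈-+ (≈-refl {1}) (≈-* (≈-sym v≈u+k) (≈-refl {c})) ⟩
        suc (v * c)            ∎
        where
        open ≈-Reasoning
        identity : ∀ u k c → u * c + (c * k + 1) ≡ suc ((u + k) * c)
        identity = solve-∀
      from : u * c ≈ suc (v * c) → v ≈ u + k
      from uc≈1+vc = begin
        v                          ≡⟨ +-identityʳ v ⟨
        v + 0                      ≡⟨ cong (v +_) (*-zeroʳ u) ⟨
        v + u * 0                  ≈⟨ ≈-+ (≈-refl {v}) (≈-* (≈-refl {u}) inverse) ⟨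
        v + u * (c * k + 1)        ≡⟨ identity₁ u v c k ⟩
        u + (v + u * c * k)        ≈⟨ ≈-+ (≈-refl {u}) (≈-+ (≈-refl {v}) (≈-* uc≈1+vc (≈-refl {k}))) ⟩
        u + (v + suc (v * c) * k)  ≡⟨ identity₂ u v c k ⟩
        (u + k) + v * (c * k + 1)  ≈⟨ ≈-+ (≈-refl {u + k}) (≈-* (≈-refl {v}) inverse) ⟩
        (u + k) + v * 0            ≡⟨ cong ((u + k) +_) (*-zeroʳ v) ⟩
        (u + k) + 0                ≡⟨ +-identityʳ (u + k) ⟩
        u + k                      ∎
        where
        open ≈-Reasoning
        identity₁ : ∀ u v c k → v + u * (c * k + 1) ≡ u + (v + u * c * k)
        identity₁ = solve-∀
        identity₂ : ∀ u v c k → u + (v + suc (v * c) * k) ≡ (u + k) + v * (c * k + 1)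
        identity₂ = solve-∀

-- The case m = 2k

at : Bool → ℕ → ℕ
at false a = 2 * a
at true  a = suc (2 * a)

at-< : ∀ i j {a b} → a < b → at i a < at j b
at-< i j {a} {b} a<b = begin-strict
  at i a             ≤⟨ at≤ i ⟩
  suc (2 * a)        <⟨ n<1+n _ ⟩
  suc (suc (2 * a))  ≡⟨ *-suc 2 a ⟨
  2 * suc a          ≤⟨ *-monoʳ-≤ 2 a<b ⟩
  2 * b              ≤⟨ at≥ j ⟩
  at j b             ∎
  where
  open ≤-Reasoning
  at≤ : ∀ i → at i a ≤ suc (2 * a)
  at≤ false = n≤1+n _
  at≤ true  = ≤-refl
  at≥ : ∀ j → 2 * b ≤ at j b
  at≥ false = ≤-refl
  at≥ true  = n≤1+n _

module Antipodal (k : ℕ) (0<k : 0 < k) where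

  m : ℕ
  m = 2 * k

  instance
    m-nonZero : NonZero m
    m-nonZero = >-nonZero (*-monoʳ-< 2 0<k)

  pairPositions : Bool → ℕ → List ℕ
  pairPositions b s = at b s ∷ at (not b) (k + s) ∷ []

  positions : ℕ → List ℕ
  positions r = if r <ᵇ k then pairPositions false r else pairPositions true (r ∸ k)

  Conflict : ℕ → ℕ → Set
  Conflict r r′ = r′ ≡ (r + k) % m

  data Half : ℕ → Set where
    lower : ∀ {s} → s < k → Half s
    upper : ∀ {s} → s < k → Half (k + s)

  m≡k+k : m ≡ k + k
  m≡k+k = cong (k +_) (+-identityʳ k)

  half : ∀ {r} → r < m → Half r
  half {r} r<m with r <? k
  ... | yes r<k = lower r<k
  ... | no  r≮k = subst Half k+[r∸k]≡r (upper (+-cancelˡ-< k (r ∸ k) k (subst₂ _<_ (sym k+[r∸k]≡r) m≡k+k r<m)))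
    where
    k+[r∸k]≡r : k + (r ∸ k) ≡ r
    k+[r∸k]≡r = m+[n∸m]≡n (≮⇒≥ r≮k)

  positions-lower : ∀ {s} → s < k → positions s ≡ pairPositions false s
  positions-lower {s} s<k with s <ᵇ k | <⇒<ᵇ s<k
  ... | true | _ = refl

  positions-upper : ∀ {s} → s < k → positions (k + s) ≡ pairPositions true s
  positions-upper {s} s<k with k + s <ᵇ k | <ᵇ⇒< (k + s) k
  ... | true  | k+s<k = contradiction (k+s<k _) (m+n≮m k s)
  ... | false | _     = cong (pairPositions true) (m+n∸m≡n k s)

  antipode-lower : ∀ {s} → s < k → (s + k) % m ≡ k + s
  antipode-lower {s} s<k = trans (m<n⇒m%n≡m (subst (s + k <_) (sym m≡k+k) (+-monoˡ-< k s<k))) (+-comm s k)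

  antipode-upper : ∀ {s} → s < k → (k + s + k) % m ≡ s
  antipode-upper {s} s<k = begin
    (k + s + k) % m ≡⟨ cong (_% m) (trans (cong (_+ k) (+-comm k s)) (trans (+-assoc s k k) (cong (s +_) (sym m≡k+k)))) ⟩
    (s + m) % m     ≡⟨ [m+n]%n≡m%n s m ⟩
    s % m           ≡⟨ m<n⇒m%n≡m (<-≤-trans s<k (subst (k ≤_) (sym m≡k+k) (m≤m+n k k))) ⟩
    s               ∎
    where open ≡-Reasoning

  ascending-pair : ∀ b s → AscendingFrom 0 (pairPositions b s)
  ascending-pair b s = z≤n ∷ (at-< b (not b) (m<n+m s 0<k) ∷ [])

  module _ {A : Set} (x y : A) where
    open Merge x y

    private
      s<k+s′ : ∀ {s} s′ → s < k → s < k + s′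
      s<k+s′ s′ s<k = <-≤-trans s<k (m≤m+n k s′)

    merge-pairs-ordered : ∀ b b′ {s s′} → s < s′ → s′ < k
                        → merge (pairPositions b s) (pairPositions b′ s′) ≡ x ∷ y ∷ x ∷ y ∷ []
    merge-pairs-ordered b b′ {s} s<s′ s′<k = merge-xyxy (<⇒≤ (at-< b b′ s<s′)) (at-< b′ (not b) (s<k+s′ s s′<k))
                                               (<⇒≤ (at-< (not b) (not b′) (+-monoʳ-< k s<s′)))

    merge-pairs-reversed : ∀ b b′ {s s′} → s′ < s → s < k
                         → merge (pairPositions b s) (pairPositions b′ s′) ≡ y ∷ x ∷ y ∷ x ∷ []
    merge-pairs-reversed b b′ {s′ = s′} s′<s s<k = merge-yxyx (at-< b′ b s′<s) (<⇒≤ (at-< b (not b′) (s<k+s′ s′ s<k)))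
                                                    (at-< (not b′) (not b) (+-monoʳ-< k s′<s))

    merge-pairs-lower-upper : ∀ s → merge (pairPositions false s) (pairPositions true s) ≡ x ∷ y ∷ y ∷ x ∷ []
    merge-pairs-lower-upper s = merge-xyyx (n≤1+n _) (at-< true false (m<n+m s 0<k)) (n<1+n _)

    merge-pairs-upper-lower : ∀ s → merge (pairPositions true s) (pairPositions false s) ≡ y ∷ x ∷ x ∷ y ∷ []
    merge-pairs-upper-lower s = merge-yxxy (n<1+n _) (at-< true false (m<n+m s 0<k)) (n≤1+n _)

    alternating-distinct : ∀ b b′ {s s′} → s < k → s′ < k → s ≢ s′
                         → Alternating x y (merge (pairPositions b s) (pairPositions b′ s′))
    alternating-distinct b b′ {s} {s′} s<k s′<k s≢s′ with <-cmp s s′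
    ... | tri< s<s′ _ _ = 4 , inj₁ (merge-pairs-ordered b b′ s<s′ s′<k)
    ... | tri≈ _ s≡s′ _ = contradiction s≡s′ s≢s′
    ... | tri> _ _ s′<s = 4 , inj₂ (merge-pairs-reversed b b′ s′<s s<k)

    alternating-same-half : ∀ b {s s′} → s < k → s′ < k → Alternating x y (merge (pairPositions b s) (pairPositions b s′))
    alternating-same-half b {s} {s′} s<k s′<k with s ≟ s′
    ... | yes refl  = let l , e = merge-self (ascending-pair b s) in l , inj₁ e
    ... | no  s≢s′ = alternating-distinct b b s<k s′<k s≢s′

    classify-halves : ∀ {r r′} → Half r → Half r′ → Classified x y (Conflict r r′) (merge (positions r) (positions r′))
    classify-halves (lower {s} s<k) (lower {s′} s′<k)
      rewrite positions-lower s<k | positions-lower s′<k | antipode-lower s<k =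
      inj₂ ((λ s′≡k+s → <⇒≱ s′<k (subst (k ≤_) (sym s′≡k+s) (m≤m+n k s))) , alternating-same-half false s<k s′<k)
    classify-halves (lower {s} s<k) (upper {s′} s′<k)
      rewrite positions-lower s<k | positions-upper s′<k | antipode-lower s<k with s ≟ s′
    ... | yes refl = inj₁ (refl , (x ∷ []) , (x ∷ []) , y , merge-pairs-lower-upper s)
    ... | no  s≢s′ = inj₂ ((λ e → s≢s′ (sym (+-cancelˡ-≡ k s′ s e))) , alternating-distinct false true s<k s′<k s≢s′)
    classify-halves (upper {s} s<k) (lower {s′} s′<k)
      rewrite positions-upper s<k | positions-lower s′<k | antipode-upper s<k with s ≟ s′
    ... | yes refl = inj₁ (refl , (y ∷ []) , (y ∷ []) , x , merge-pairs-upper-lower s)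
    ... | no  s≢s′ = inj₂ ((λ e → s≢s′ (sym e)) , alternating-distinct true false s<k s′<k s≢s′)
    classify-halves (upper {s} s<k) (upper {s′} s′<k)
      rewrite positions-upper s<k | positions-upper s′<k | antipode-upper s<k =
      inj₂ ((λ k+s′≡s → <⇒≱ s<k (subst (k ≤_) k+s′≡s (m≤m+n k s′))) , alternating-same-half true s<k s′<k)

  open Congruence m

  pair-bounded : ∀ b {s} → s < k → All (_< 2 * m) (pairPositions b s)
  pair-bounded b {s} s<k = at-< b false (<-≤-trans s<k k≤m) ∷ (at-< (not b) false k+s<m ∷ [])
    where
    k≤m = subst (k ≤_) (sym m≡k+k) (m≤m+n k k)
    k+s<m = subst (k + s <_) (sym m≡k+k) (+-monoʳ-< k s<k)

  scheme : PositionScheme k m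
  scheme = record
    { class     = _% m
    ; class<    = λ v → m%n<n v m
    ; positions = positions
    ; width     = 2 * m
    ; ascending = λ r r<m → ascending (half r<m)
    ; bounded   = λ r r<m → bounded (half r<m)
    ; Conflict  = Conflict
    ; conflict⇔ = λ {u} u<v → ⇔-trans (∣-∣≈⇔ k (<⇒≤ u<v)) (mk⇔ (λ e → trans e (≈-+ (≈-sym (≈-% u)) ≈-refl)) (λ e → trans e (≈-+ (≈-% u) ≈-refl)))
    ; classify  = λ x y r r′ r<m r′<m → classify-halves x y (half r<m) (half r′<m)
    }
    where
    ascending : ∀ {r} → Half r → AscendingFrom 0 (positions r)
    ascending (lower s<k) rewrite positions-lower s<k = ascending-pair false _
    ascending (upper s<k) rewrite positions-upper s<k = ascending-pair true _
    bounded : ∀ {r} → Half r → All (_< 2 * m) (positions r)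
    bounded (lower s<k) rewrite positions-lower s<k = pair-bounded false s<k
    bounded (upper s<k) rewrite positions-upper s<k = pair-bounded true s<k

  wordRepresentable : ∀ n → WordRepresentable (ToeplitzSingleZero n k m)
  wordRepresentable = scheme⇒wordRepresentable scheme

-- The case gcd(k, m) = 1

module _ {k m : ℕ} .{{_ : NonZero m}} where
  open Congruence m

  consecutiveScheme : (∃ λ c → c * k + 1 ≈ 0) → (positions : ℕ → List ℕ) (width : ℕ)
    → (∀ r → r < m → AscendingFrom 0 (positions r))
    → (∀ r → r < m → All (_< width) (positions r))
    → (∀ {A : Set} (x y : A) r s → r < m → s < m
         → Classified x y (r ≡ suc s % m) (Merge.merge x y (positions r) (positions s)))
    → PositionScheme k m
  consecutiveScheme (c , inverse) positions width ascending bounded classify = record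
    { class     = λ v → (v * c) % m
    ; class<    = λ v → m%n<n (v * c) m
    ; positions = positions
    ; width     = width
    ; ascending = ascending
    ; bounded   = bounded
    ; Conflict  = λ r s → r ≡ suc s % m
    ; conflict⇔ = λ {u} {v} u<v → ⇔-trans (∣-∣≈⇔ k (<⇒≤ u<v)) (⇔-trans (≈+k⇔*-inverse inverse)
                    (mk⇔ (λ e → trans e (sym (reduce v))) (λ e → trans e (reduce v))))
    ; classify  = classify
    }
    where
    reduce : ∀ v → suc ((v * c) % m) % m ≡ suc (v * c) % m
    reduce v = ≈-+ (≈-refl {1}) (≈-% (v * c))

⌈n/2⌉-cases : ∀ n → ⌈ n /2⌉ ≡ ⌊ n /2⌋ ⊎ ⌈ n /2⌉ ≡ suc ⌊ n /2⌋
⌈n/2⌉-cases zero          = inj₁ refl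
⌈n/2⌉-cases (suc zero)    = inj₂ refl
⌈n/2⌉-cases (suc (suc n)) = Sum.map (cong suc) (cong suc) (⌈n/2⌉-cases n)

suc-%-wrap : ∀ {v m} .{{_ : NonZero m}} → v < m → ¬ suc v < m → suc v % m ≡ 0
suc-%-wrap {v} {m} v<m v+1≮m = trans (cong (_% m) (≤-antisym v<m (≮⇒≥ v+1≮m))) (n%n≡0 m)

module Staircase (H : ℕ) (1≤H : 1 ≤ H) where

  stair : ℕ → List ℕ
  stair u = ⌊ u /2⌋ ∷ ⌈ u /2⌉ + H ∷ []

  ascending-stair : ∀ u → AscendingFrom 0 (stair u)
  ascending-stair u = z≤n ∷ (≤-<-trans (⌊n/2⌋≤⌈n/2⌉ u) (m<m+n _ 1≤H) ∷ [])

  module _ {A : Set} (x y : A) where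
    open Merge x y

    merge-stairs-ascending : ∀ {u v} → u ≤ v → ⌊ v /2⌋ < ⌈ u /2⌉ + H → merge (stair u) (stair v) ≡ x ∷ y ∷ x ∷ y ∷ []
    merge-stairs-ascending u≤v v<u+H = merge-xyxy (⌊n/2⌋-mono u≤v) v<u+H (+-monoˡ-≤ H (⌈n/2⌉-mono u≤v))

    merge-stairs-descending : ∀ {u v} → suc (suc v) ≤ u → ⌊ u /2⌋ ≤ ⌈ v /2⌉ + H
                            → merge (stair u) (stair v) ≡ y ∷ x ∷ y ∷ x ∷ []
    merge-stairs-descending v+2≤u u≤v+H = merge-yxyx (⌊n/2⌋-mono v+2≤u) u≤v+H (+-monoˡ-< H (⌈n/2⌉-mono v+2≤u))

    merge-stairs-step-down : ∀ v → HasRepeat (merge (stair (suc v)) (stair v))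
    merge-stairs-step-down v with ⌈n/2⌉-cases v
    ... | inj₁ e = (x ∷ []) , (x ∷ []) , y ,
      merge-xyyx (≤-reflexive e) (≤-<-trans (⌊n/2⌋≤⌈n/2⌉ v) (m<m+n _ 1≤H)) (+-monoˡ-< H (s≤s (≤-reflexive e)))
    ... | inj₂ e = (y ∷ []) , (y ∷ []) , x ,
      merge-yxxy (≤-reflexive (sym e)) (subst (_< suc ⌊ v /2⌋ + H) (sym e) (m<m+n _ 1≤H)) (+-monoˡ-≤ H (≤-reflexive (sym e)))

  ⌊n/2⌋≤H : ∀ {n} → n ≤ suc (H + H) → ⌊ n /2⌋ ≤ H
  ⌊n/2⌋≤H n≤ = ≤-trans (⌊n/2⌋-mono n≤) (≤-reflexive (sym (n≡⌈n+n/2⌉ H)))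

  module _ (m : ℕ) .{{_ : NonZero m}} (m≤ : m ≤ suc (H + H)) {A : Set} (x y : A) where
    open Merge x y

    private
      <m⇒≤ : ∀ {v} → v < m → v ≤ suc (H + H)
      <m⇒≤ v<m = ≤-trans (<⇒≤ v<m) m≤

    classify-stairs : ∀ {u v} → 0 < u → u < m → v < m
                    → Classified x y (u ≡ suc v % m) (merge (stair u) (stair v))
    classify-stairs {u} {v} 0<u u<m v<m with <-cmp u (suc v)
    ... | tri< u≤v _ _ = inj₂ (¬conflict , 4 , inj₁ (merge-stairs-ascending x y (≤-pred u≤v)
                                (≤-<-trans (⌊n/2⌋≤H (<m⇒≤ v<m)) (m<n+m H (⌈n/2⌉-mono 0<u)))))
      where
      ¬conflict : u ≢ suc v % m
      ¬conflict u≡ with suc v <? m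
      ... | yes v+1<m = <-irrefl (trans u≡ (m<n⇒m%n≡m v+1<m)) u≤v
      ... | no  v+1≮m = <-irrefl (sym (trans u≡ (suc-%-wrap v<m v+1≮m))) 0<u
    ... | tri≈ _ refl _ = inj₁ (sym (m<n⇒m%n≡m u<m) , merge-stairs-step-down x y v)
    ... | tri> _ _ v+1<u = inj₂ ((λ u≡ → <-irrefl (sym (trans u≡ (m<n⇒m%n≡m (<-trans v+1<u u<m)))) v+1<u) ,
                                 4 , inj₂ (merge-stairs-descending x y v+1<u (≤-trans (⌊n/2⌋≤H (<m⇒≤ u<m)) (m≤n+m H _))))

  stair-bounded : ∀ {u} → u ≤ H + H → All (_< suc (H + H)) (stair u)
  stair-bounded {u} u≤ = s≤s (≤-trans (⌊n/2⌋≤H (m≤n⇒m≤1+n u≤)) (m≤n+m H H)) ∷ (s≤s (+-monoˡ-≤ H (⌊n/2⌋≤H (s≤s u≤))) ∷ [])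

module OddStaircase (H : ℕ) (1≤H : 1 ≤ H) where
  open Staircase H 1≤H

  m : ℕ
  m = suc (H + H)

  module _ {A : Set} (x y : A) where
    open Merge x y

    classify-from-zero : ∀ {v} → v < m → Classified x y (0 ≡ suc v % m) (merge (stair 0) (stair v))
    classify-from-zero {v} v<m with suc v <? m
    ... | yes v+1<m = inj₂ ((λ 0≡ → 0≢1+n (trans 0≡ (m<n⇒m%n≡m v+1<m))) ,
                            4 , inj₁ (merge-stairs-ascending x y z≤n (⌊n/2⌋≤H v+1<m)))
    ... | no  v+1≮m = inj₁ (sym (suc-%-wrap v<m v+1≮m) , [] , (y ∷ y ∷ []) , x ,
                            merge-xxyy 1≤H (≤-reflexive (trans (n≡⌊n+n/2⌋ H) (cong ⌊_/2⌋ (sym v≡H+H)))))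
      where
      v≡H+H : v ≡ H + H
      v≡H+H = suc-injective (≤-antisym v<m (≮⇒≥ v+1≮m))

  classify : ∀ {A : Set} (x y : A) u v → u < m → v < m → Classified x y (u ≡ suc v % m) (Merge.merge x y (stair u) (stair v))
  classify x y zero    v u<m v<m = classify-from-zero x y v<m
  classify x y (suc u) v u<m v<m = classify-stairs m ≤-refl x y (s≤s z≤n) u<m v<m

  scheme : ∀ k → gcd k m ≡ 1 → PositionScheme k m
  scheme k gcd≡1 = consecutiveScheme (Congruence.negativeInverse m gcd≡1) stair m
    (λ r _ → ascending-stair r) (λ r r<m → stair-bounded (≤-pred r<m)) classify

module EvenStaircase (H : ℕ) (2≤H : 2 ≤ H) where
  1≤H : 1 ≤ H
  1≤H = ≤-trans (s≤s z≤n) 2≤H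

  open Staircase H 1≤H

  m : ℕ
  m = H + H

  -- With the pair 0, H alone, class 0 would cross class m - 1 instead of failing to alternate with it.
  positions : ℕ → List ℕ
  positions zero    = 0 ∷ H ∷ H + H ∷ []
  positions (suc u) = stair (suc u)

  H<H+H : H < H + H
  H<H+H = m<m+n H 1≤H

  1<m : 1 < m
  1<m = ≤-trans (s≤s 1≤H) H<H+H

  instance
    m-nonZero : NonZero m
    m-nonZero = >-nonZero (<-trans z<s 1<m)

  ascending-positions : ∀ u → AscendingFrom 0 (positions u)
  ascending-positions zero    = z≤n ∷ (1≤H ∷ (H<H+H ∷ []))
  ascending-positions (suc u) = ascending-stair (suc u)

  module _ {A : Set} (x y : A) where
    open Merge x y

    classify-from-zero : ∀ {v} → suc v < m
                       → Classified x y (0 ≡ suc (suc v) % m) (merge (positions 0) (positions (suc v)))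
    classify-from-zero {v} v+1<m with suc (suc v) <? m
    ... | yes v+2<m = inj₂ ((λ 0≡ → 0≢1+n (trans 0≡ (m<n⇒m%n≡m v+2<m))) ,
                            5 , inj₁ (merge-xyxyx z≤n (⌊n/2⌋≤H (s≤s v+1<m)) (m≤n+m H _) (+-monoˡ-< H (⌊n/2⌋≤H (s≤s v+2<m)))))
    ... | no  v+2≮m = inj₁ (sym (suc-%-wrap v+1<m v+2≮m) , (x ∷ y ∷ []) , (y ∷ []) , x ,
                            merge-xyxxy z≤n (⌊n/2⌋≤H (s≤s v+1<m)) H<H+H (+-monoˡ-≤ H H≤⌈v+1/2⌉))
      where
      H≤⌈v+1/2⌉ : H ≤ ⌈ suc v /2⌉
      H≤⌈v+1/2⌉ = ≤-reflexive (trans (n≡⌊n+n/2⌋ H) (cong ⌊_/2⌋ (sym (≤-antisym v+1<m (≮⇒≥ v+2≮m)))))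

    classify-to-zero : ∀ {u} → suc u < m
                     → Classified x y (suc u ≡ 1 % m) (merge (positions (suc u)) (positions 0))
    classify-to-zero {zero} _ = inj₁ (sym (m<n⇒m%n≡m 1<m) , (x ∷ []) , (x ∷ y ∷ []) , y ,
                                      merge-xyyxy z≤n 1≤H ≤-refl H<H+H)
    classify-to-zero {suc u} u+2<m = inj₂ ((λ e → 1+n≢0 (suc-injective (trans e (m<n⇒m%n≡m 1<m)))) ,
                                          5 , inj₂ (merge-yxyxy (s≤s z≤n) (⌊n/2⌋≤H (m≤n⇒m≤1+n (<⇒≤ u+2<m)))
                                                                (m<n+m H (s≤s z≤n)) (+-monoˡ-≤ H (⌊n/2⌋≤H (m≤n⇒m≤1+n u+2<m)))))

  classify : ∀ {A : Set} (x y : A) u v → u < m → v < m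
           → Classified x y (u ≡ suc v % m) (Merge.merge x y (positions u) (positions v))
  classify x y zero    zero    _   _   = inj₂ ((λ 0≡ → 0≢1+n (trans 0≡ (m<n⇒m%n≡m 1<m))) ,
                                               let l , e = Merge.merge-self x y (ascending-positions 0) in l , inj₁ e)
  classify x y zero    (suc v) _   v<m = classify-from-zero x y v<m
  classify x y (suc u) zero    u<m _   = classify-to-zero x y u<m
  classify x y (suc u) (suc v) u<m v<m = classify-stairs m (n≤1+n m) x y (s≤s z≤n) u<m v<m

  bounded : ∀ r → r < m → All (_< suc m) (positions r)
  bounded zero    _   = s≤s z≤n ∷ (s≤s (<⇒≤ H<H+H) ∷ (≤-refl ∷ []))
  bounded (suc u) u<m = stair-bounded (<⇒≤ u<m)

  scheme : ∀ k → gcd k m ≡ 1 → PositionScheme k m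
  scheme k gcd≡1 = consecutiveScheme (Congruence.negativeInverse m gcd≡1) positions (suc m)
    (λ r _ → ascending-positions r) bounded classify

even-or-odd : ∀ n → ∃ λ H → n ≡ H + H ⊎ n ≡ suc (H + H)
even-or-odd zero = 0 , inj₁ refl
even-or-odd (suc n) with even-or-odd n
... | H , inj₁ n≡ = H , inj₂ (cong suc n≡)
... | H , inj₂ n≡ = suc H , inj₁ (cong suc (trans n≡ (sym (+-suc H H))))

coprime⇒wordRepresentable : ∀ {k m} .{{_ : NonZero m}} → 0 < k → k < m → gcd k m ≡ 1 → m ≢ 2 * k
                          → ∀ n → WordRepresentable (ToeplitzSingleZero n k m)
coprime⇒wordRepresentable {k} {m} 0<k k<m gcd≡1 m≢2k with even-or-odd m
... | zero        , inj₁ refl = contradiction (<-trans 0<k k<m) (λ ())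
... | suc zero    , inj₁ refl = contradiction (sym (cong (2 *_) (≤-antisym (≤-pred k<m) 0<k))) m≢2k
... | suc (suc H) , inj₁ refl = scheme⇒wordRepresentable (EvenStaircase.scheme (suc (suc H)) (s≤s (s≤s z≤n)) k gcd≡1)
... | zero        , inj₂ refl = contradiction (≤-pred k<m) (<⇒≱ 0<k)
... | suc H       , inj₂ refl = scheme⇒wordRepresentable (OddStaircase.scheme (suc H) (s≤s z≤n) k gcd≡1)

theorem7 : (k m : ℕ) → 0 < k → k < m → .{{_ : NonZero m}}
    → (gcd k m ≡ 1 ⊎ m ≡ 2 * k)
    → (n : ℕ) → 0 < n → WordRepresentable (ToeplitzSingleZero n k m)
theorem7 k m 0<k k<m (inj₂ refl) n _ = Antipodal.wordRepresentable k 0<k n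
theorem7 k m 0<k k<m (inj₁ gcd≡1) n _ with m ≟ 2 * k
... | yes refl = Antipodal.wordRepresentable k 0<k n
... | no  m≢2k = coprime⇒wordRepresentable 0<k k<m gcd≡1 m≢2k n
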